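{- Let $n \in \mathbb{N}$, let $\phi \colon \{0,1\}^n \to \{0,1\}^n$ be a bijection from ${\sf XOR}$ to ${\sf Majority}$ (i.e. ${\sf XOR}(z) = {\sf Majority}(\phi(z))$ for all $z$), and let $i \in [n]$. Then $\mathbb{E}_x[{\sf dist}(\phi(x),\phi(x+e_i))] \ge c\sqrt{n}$, where $x$ is uniform in $\{0,1\}^n$ and $c>0$ is an absolute constant.
   Context: ${\sf Majority}(x) = 1$ if $\sum_i x_i > n/2$ and $0$ otherwise; ${\sf XOR}(x) = \sum_i x_i \bmod 2$. ${\sf dist}$ is Hamming distance; $e_i$ is the $i$-th standard basis vector and addition is mod 2. -}

module Defs where

open import Data.Bool using (Bool; true; false; _xor_; not)
open import Data.Nat using (ℕ; zero; suc; _+_; _*_; _<ᵇ_)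
open import Data.Fin using (Fin)
open import Data.Vec using (Vec; []; _∷_; foldr; zipWith; updateAt)
open import Data.Nat.ListAction using (sum)
open import Data.List using (List; concatMap; map) renaming ([] to []ˡ; _∷_ to _∷ˡ_)

-- {0,1}^n, with 0 = false and 1 = true
Cube : ℕ → Set
Cube n = Vec Bool n

ones : ∀ {n} → Cube n → ℕ
ones [] = 0
ones (true ∷ xs) = suc (ones xs)
ones (false ∷ xs) = ones xs

XOR : ∀ {n} → Cube n → Bool
XOR = foldr _ _xor_ false

-- Majority(x) = 1 iff Σ_i x_i > n/2, i.e. n < 2 * Σ_i x_i
Majority : ∀ {n} → Cube n → Bool
Majority {n} x = n <ᵇ 2 * ones x

dist : ∀ {n} → Cube n → Cube n → ℕ
dist x y = ones (zipWith _xor_ x y)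

_+e_ : ∀ {n} → Cube n → Fin n → Cube n
x +e i = updateAt x i not

allCube : (n : ℕ) → List (Cube n)
allCube zero = [] ∷ˡ []ˡ
allCube (suc n) = concatMap (λ x → (false ∷ x) ∷ˡ (true ∷ x) ∷ˡ []ˡ) (allCube n)

sumCube : (n : ℕ) → (Cube n → ℕ) → ℕ
sumCube n f = sum (map f (allCube n))

module Submission where

-- Proposition 7: if a bijection φ of {0,1}^n turns XOR into Majority, then in
-- every direction i the average distance E_x dist(φ x, φ(x+e_i)) is at least
-- √n / 3.  Writing S = Σ_x dist(φ x, φ(x+e_i)), this is n·4^n ≤ 9·S².
--
-- Even n.  No such φ exists: XOR is 1 on exactly 2^(n-1) points, whereas the
-- symmetry C(n,k) = C(n,n-k) shows that Majority is 1 on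
-- (2^n - C(n,n/2)) / 2 < 2^(n-1) points.
--
-- Odd n = 2m+1.  The excess 2|y| ∸ n of a point y is positive exactly on the
-- Majority half.  As x and x+e_i differ in XOR, exactly one of φ x, φ(x+e_i) is a
-- Majority point, so the triangle inequality for Hamming distance gives
-- excess(φ x) + excess(φ(x+e_i)) ≤ 2·dist(φ x, φ(x+e_i)).  Summing over x and
-- reindexing along φ and x ↦ x+e_i yields Σ_y excess y ≤ S.  The left side is
-- the binomial sum Σ_k C(n,k)(2k ∸ n) = n·C(2m,m), and the central binomial
-- estimate 16^m ≤ (4m+1)·C(2m,m)² turns S ≥ n·C(2m,m) into n·4^n ≤ 9·S².

open import Defs
open import Data.Bool using (Bool; true; false; not; _xor_; if_then_else_; T)
open import Data.Bool.Properties using (not-distribˡ-xor; not-distribʳ-xor; not-involutive; xor-comm)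
  renaming (_≟_ to _≟ᴮ_)
open import Data.Nat
  using (ℕ; zero; suc; _+_; _*_; _∸_; _^_; _≤_; _<_; z≤n; s≤s; _<ᵇ_; _≡ᵇ_; NonZero)
open import Data.Nat.Properties
open import Data.Nat.Tactic.RingSolver using (solve-∀)
open import Data.Nat.ListAction using (sum)
open import Data.Fin using (Fin) renaming (zero to fzero; suc to fsuc)
open import Data.Vec using ([]; _∷_)
open import Data.Vec.Properties using (≡-dec; zipWith-comm)
open import Data.List using (List; map; concatMap) renaming ([] to []ˡ; _∷_ to _∷ˡ_)
open import Data.Product using (Σ; _×_; _,_; proj₁; proj₂)
open import Data.Empty using (⊥; ⊥-elim)
open import Relation.Nullary using (does; proof)
open import Relation.Nullary.Reflects using (Reflects; ofʸ; ofⁿ; fromEquivalence)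
open import Relation.Binary.Definitions using (DecidableEquality)
open import Relation.Binary.PropositionalEquality
open import Function.Definitions using (Bijective)
open import Algebra.Properties.CommutativeSemigroup +-commutativeSemigroup using (interchange)

⟦_⟧ : Bool → ℕ
⟦ b ⟧ = if b then 1 else 0

reflects-agree : ∀ {p q} {P : Set p} {Q : Set q} {b c : Bool} →
  Reflects P b → Reflects Q c → (P → Q) → (Q → P) → b ≡ c
reflects-agree (ofʸ _) (ofʸ _) _ _ = refl
reflects-agree (ofʸ p) (ofⁿ ¬q) f _ = ⊥-elim (¬q (f p))
reflects-agree (ofⁿ ¬p) (ofʸ q) _ g = ⊥-elim (¬p (g q))
reflects-agree (ofⁿ _) (ofⁿ _) _ _ = refl

≡ᵇ-reflects-≡ : ∀ m n → Reflects (m ≡ n) (m ≡ᵇ n)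
≡ᵇ-reflects-≡ m n = fromEquivalence (≡ᵇ⇒≡ m n) (≡⇒≡ᵇ m n)

≡ᵇ-refl : ∀ n → (n ≡ᵇ n) ≡ true
≡ᵇ-refl zero = refl
≡ᵇ-refl (suc n) = ≡ᵇ-refl n

sumOver : {A : Set} → List A → (A → ℕ) → ℕ
sumOver L f = sum (map f L)

module _ {A : Set} where

  sumOver-cong : (L : List A) {f g : A → ℕ} → (∀ x → f x ≡ g x) → sumOver L f ≡ sumOver L g
  sumOver-cong []ˡ _ = refl
  sumOver-cong (x ∷ˡ L) f≡g = cong₂ _+_ (f≡g x) (sumOver-cong L f≡g)

  sumOver-mono : (L : List A) {f g : A → ℕ} → (∀ x → f x ≤ g x) → sumOver L f ≤ sumOver L g
  sumOver-mono []ˡ _ = z≤n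
  sumOver-mono (x ∷ˡ L) f≤g = +-mono-≤ (f≤g x) (sumOver-mono L f≤g)

  sumOver-zero : (L : List A) → sumOver L (λ _ → 0) ≡ 0
  sumOver-zero []ˡ = refl
  sumOver-zero (_ ∷ˡ L) = sumOver-zero L

  sumOver-+ : (L : List A) (f g : A → ℕ) → sumOver L (λ x → f x + g x) ≡ sumOver L f + sumOver L g
  sumOver-+ []ˡ _ _ = refl
  sumOver-+ (x ∷ˡ L) f g =
    trans (cong (f x + g x +_) (sumOver-+ L f g)) (interchange (f x) (g x) (sumOver L f) (sumOver L g))

  sumOver-*ˡ : (L : List A) (c : ℕ) (f : A → ℕ) → sumOver L (λ x → c * f x) ≡ c * sumOver L f
  sumOver-*ˡ []ˡ c _ = sym (*-zeroʳ c)
  sumOver-*ˡ (x ∷ˡ L) c f = trans (cong (c * f x +_) (sumOver-*ˡ L c f)) (sym (*-distribˡ-+ c (f x) _))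

  sumOver-*ʳ : (L : List A) (f : A → ℕ) (c : ℕ) → sumOver L (λ x → f x * c) ≡ sumOver L f * c
  sumOver-*ʳ []ˡ _ _ = refl
  sumOver-*ʳ (x ∷ˡ L) f c = trans (cong (f x * c +_) (sumOver-*ʳ L f c)) (sym (*-distribʳ-+ c (f x) _))

sumOver-swap : ∀ {A B : Set} (L : List A) (M : List B) (h : A → B → ℕ) →
  sumOver L (λ x → sumOver M (h x)) ≡ sumOver M (λ y → sumOver L (λ x → h x y))
sumOver-swap []ˡ M _ = sym (sumOver-zero M)
sumOver-swap (x ∷ˡ L) M h =
  trans (cong (sumOver M (h x) +_) (sumOver-swap L M h)) (sym (sumOver-+ M (h x) _))

sumCube-split : ∀ n (f : Cube (suc n) → ℕ) →
  sumCube (suc n) f ≡ sumCube n (λ x → f (false ∷ x)) + sumCube n (λ x → f (true ∷ x))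
sumCube-split n f = go (allCube n)
  where
  go : (L : List (Cube n)) →
    sum (map f (concatMap (λ x → (false ∷ x) ∷ˡ (true ∷ x) ∷ˡ []ˡ) L))
      ≡ sumOver L (λ x → f (false ∷ x)) + sumOver L (λ x → f (true ∷ x))
  go []ˡ = refl
  go (x ∷ˡ L) = begin
    a + (b + _)                  ≡⟨ sym (+-assoc a b _) ⟩
    a + b + _                    ≡⟨ cong (a + b +_) (go L) ⟩
    a + b + (c + d)              ≡⟨ interchange a b c d ⟩
    a + c + (b + d)              ∎
    where
    open ≡-Reasoning
    a = f (false ∷ x)
    b = f (true ∷ x)
    c = sumOver L (λ x → f (false ∷ x))
    d = sumOver L (λ x → f (true ∷ x))

_≟ᶜ_ : ∀ {n} → DecidableEquality (Cube n)
_≟ᶜ_ = ≡-dec _≟ᴮ_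

δ : ∀ {n} → Cube n → Cube n → ℕ
δ x y = ⟦ does (x ≟ᶜ y) ⟧

δ-cong : ∀ {n} {x y x′ y′ : Cube n} →
  (x ≡ y → x′ ≡ y′) → (x′ ≡ y′ → x ≡ y) → δ x y ≡ δ x′ y′
δ-cong {x = x} {y} {x′} {y′} f g =
  cong ⟦_⟧ (reflects-agree (proof (x ≟ᶜ y)) (proof (x′ ≟ᶜ y′)) f g)

sumCube-δ : ∀ n (z : Cube n) (f : Cube n → ℕ) → sumCube n (λ y → δ z y * f y) ≡ f z
sumCube-δ zero [] f = trans (+-identityʳ _) (*-identityˡ (f []))
sumCube-δ (suc n) (false ∷ z) f = begin
  sumCube (suc n) (λ y → δ (false ∷ z) y * f y)         ≡⟨ sumCube-split n _ ⟩
  sumCube n (λ y → δ z y * f (false ∷ y)) + sumCube n (λ _ → 0)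
    ≡⟨ cong₂ _+_ (sumCube-δ n z (λ y → f (false ∷ y))) (sumOver-zero (allCube n)) ⟩
  f (false ∷ z) + 0                                      ≡⟨ +-identityʳ _ ⟩
  f (false ∷ z)                                          ∎
  where open ≡-Reasoning
sumCube-δ (suc n) (true ∷ z) f = begin
  sumCube (suc n) (λ y → δ (true ∷ z) y * f y)          ≡⟨ sumCube-split n _ ⟩
  sumCube n (λ _ → 0) + sumCube n (λ y → δ z y * f (true ∷ y))
    ≡⟨ cong₂ _+_ (sumOver-zero (allCube n)) (sumCube-δ n z (λ y → f (true ∷ y))) ⟩
  f (true ∷ z)                                           ∎
  where open ≡-Reasoning

sumCube-reindex : ∀ n {φ : Cube n → Cube n} → Bijective _≡_ _≡_ φ → (f : Cube n → ℕ) →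
  sumCube n (λ x → f (φ x)) ≡ sumCube n f
sumCube-reindex n {φ} (injective , surjective) f = begin
  sumCube n (λ x → f (φ x))
    ≡⟨ sumOver-cong L (λ x → sym (sumCube-δ n (φ x) f)) ⟩
  sumOver L (λ x → sumOver L (λ y → δ (φ x) y * f y))
    ≡⟨ sumOver-swap L L (λ x y → δ (φ x) y * f y) ⟩
  sumOver L (λ y → sumOver L (λ x → δ (φ x) y * f y))
    ≡⟨ sumOver-cong L (λ y → sumOver-*ʳ L (λ x → δ (φ x) y) (f y)) ⟩
  sumOver L (λ y → sumOver L (λ x → δ (φ x) y) * f y)
    ≡⟨ sumOver-cong L (λ y → trans (cong (_* f y) (preimage-count y)) (*-identityˡ (f y))) ⟩
  sumCube n f ∎
  where
  open ≡-Reasoning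
  L = allCube n
  preimage-count : ∀ y → sumOver L (λ x → δ (φ x) y) ≡ 1
  preimage-count y = trans (sumOver-cong L δ-swap) (sumCube-δ n ψy (λ _ → 1))
    where
    ψy = proj₁ (surjective y)
    φψy≡y : φ ψy ≡ y
    φψy≡y = proj₂ (surjective y) refl
    δ-swap : ∀ x → δ (φ x) y ≡ δ ψy x * 1
    δ-swap x = trans (δ-cong (λ φx≡y → injective (trans φψy≡y (sym φx≡y)))
                             (λ ψy≡x → trans (cong φ (sym ψy≡x)) φψy≡y))
                     (sym (*-identityʳ _))

flip-involutive : ∀ {n} (x : Cube n) (i : Fin n) → (x +e i) +e i ≡ x
flip-involutive (b ∷ x) fzero = cong (_∷ x) (not-involutive b)
flip-involutive (b ∷ x) (fsuc i) = cong (b ∷_) (flip-involutive x i)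

flip-bijective : ∀ {n} (i : Fin n) → Bijective _≡_ _≡_ (_+e i)
flip-bijective i =
  (λ {x} {y} e → trans (sym (flip-involutive x i)) (trans (cong (_+e i) e) (flip-involutive y i))) ,
  (λ y → (y +e i) , λ e → trans (cong (_+e i) e) (flip-involutive y i))

XOR-flip : ∀ {n} (x : Cube n) (i : Fin n) → XOR (x +e i) ≡ not (XOR x)
XOR-flip (b ∷ x) fzero = sym (not-distribˡ-xor b (XOR x))
XOR-flip (b ∷ x) (fsuc i) = trans (cong (b xor_) (XOR-flip x i)) (sym (not-distribʳ-xor b (XOR x)))

dist-comm : ∀ {n} (a b : Cube n) → dist a b ≡ dist b a
dist-comm a b = cong ones (zipWith-comm xor-comm a b)

ones-triangle : ∀ {n} (a b : Cube n) → ones a ≤ ones b + dist a b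
ones-triangle [] [] = z≤n
ones-triangle (true ∷ a) (true ∷ b) = s≤s (ones-triangle a b)
ones-triangle (true ∷ a) (false ∷ b) = ≤-trans (s≤s (ones-triangle a b)) (≤-reflexive (sym (+-suc _ _)))
ones-triangle (false ∷ a) (true ∷ b) =
  m≤n⇒m≤1+n (≤-trans (ones-triangle a b) (+-monoʳ-≤ (ones b) (n≤1+n _)))
ones-triangle (false ∷ a) (false ∷ b) = ones-triangle a b

-- Binomially weighted sums

-- bsum n F = Σ_{k=0}^{n} C(n,k) · F k, computed by Pascal's rule.
bsum : ℕ → (ℕ → ℕ) → ℕ
bsum zero F = F 0
bsum (suc n) F = bsum n F + bsum n (λ k → F (suc k))

sumCube-ones : ∀ n (F : ℕ → ℕ) → sumCube n (λ y → F (ones y)) ≡ bsum n F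
sumCube-ones zero F = +-identityʳ (F 0)
sumCube-ones (suc n) F =
  trans (sumCube-split n _) (cong₂ _+_ (sumCube-ones n F) (sumCube-ones n (λ k → F (suc k))))

bsum-cong : ∀ n {F G : ℕ → ℕ} → (∀ k → F k ≡ G k) → bsum n F ≡ bsum n G
bsum-cong zero F≡G = F≡G 0
bsum-cong (suc n) F≡G = cong₂ _+_ (bsum-cong n F≡G) (bsum-cong n (λ k → F≡G (suc k)))

bsum-+ : ∀ n (F G : ℕ → ℕ) → bsum n (λ k → F k + G k) ≡ bsum n F + bsum n G
bsum-+ zero F G = refl
bsum-+ (suc n) F G = trans (cong₂ _+_ (bsum-+ n F G) (bsum-+ n (λ k → F (suc k)) (λ k → G (suc k))))
                           (interchange (bsum n F) (bsum n G) _ _)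

bsum-*ˡ : ∀ n c (F : ℕ → ℕ) → bsum n (λ k → c * F k) ≡ c * bsum n F
bsum-*ˡ zero c F = refl
bsum-*ˡ (suc n) c F = trans (cong₂ _+_ (bsum-*ˡ n c F) (bsum-*ˡ n c (λ k → F (suc k))))
                            (sym (*-distribˡ-+ c _ _))

bsum-one : ∀ n → bsum n (λ _ → 1) ≡ 2 ^ n
bsum-one zero = refl
bsum-one (suc n) = trans (cong₂ _+_ (bsum-one n) (bsum-one n)) (cong (2 ^ n +_) (sym (+-identityʳ (2 ^ n))))

-- A single term is bounded by the sum (the coefficient C(n,k) is positive).
bsum-term : ∀ n (F : ℕ → ℕ) {k} → k ≤ n → F k ≤ bsum n F
bsum-term zero F z≤n = ≤-refl
bsum-term (suc n) F {zero} _ = ≤-trans (bsum-term n F z≤n) (m≤m+n _ _)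
bsum-term (suc n) F {suc k} (s≤s k≤n) = ≤-trans (bsum-term n (λ j → F (suc j)) k≤n) (m≤n+m _ _)

-- Symmetry C(n,k) = C(n,l) for k + l = n.
bsum-reflect : ∀ n {F G : ℕ → ℕ} → (∀ k l → k + l ≡ n → F k ≡ G l) → bsum n F ≡ bsum n G
bsum-reflect zero F≡G = F≡G 0 0 refl
bsum-reflect (suc n) {F} F≡G = trans (+-comm (bsum n F) _) (cong₂ _+_
  (bsum-reflect n (λ k l e → F≡G (suc k) l (cong suc e)))
  (bsum-reflect n (λ k l e → F≡G k (suc l) (trans (+-suc k l) (cong suc e)))))

-- Absorption k·C(n+1,k) = (n+1)·C(n,k-1).
bsum-absorb : ∀ n (F : ℕ → ℕ) → bsum (suc n) (λ k → k * F k) ≡ suc n * bsum n (λ k → F (suc k))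
bsum-absorb zero F = refl
bsum-absorb (suc n) F = begin
  bsum (suc n) (λ k → k * F k) + bsum (suc n) (λ k → F (suc k) + k * F (suc k))
    ≡⟨ cong₂ _+_ (bsum-absorb n F)
                 (trans (bsum-+ (suc n) _ _) (cong (a + b +_) (bsum-absorb n (λ k → F (suc k))))) ⟩
  suc n * a + (a + b + suc n * b)
    ≡⟨ regroup n a b ⟩
  suc (suc n) * (a + b) ∎
  where
  open ≡-Reasoning
  regroup : ∀ n a b → suc n * a + (a + b + suc n * b) ≡ suc (suc n) * (a + b)
  regroup = solve-∀
  a = bsum n (λ k → F (suc k))
  b = bsum n (λ k → F (suc (suc k)))

-- Central binomial coefficients

-- 2m, computed so that both successors of each step are visible to bsum.
twice : ℕ → ℕ
twice zero = zero
twice (suc m) = suc (suc (twice m))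

twice-≡ : ∀ m → twice m ≡ 2 * m
twice-≡ zero = refl
twice-≡ (suc m) = trans (cong (λ t → suc (suc t)) (twice-≡ m)) (step m)
  where
  step : ∀ m → suc (suc (2 * m)) ≡ 2 * suc m
  step = solve-∀

δ-subst : ∀ (F : ℕ → ℕ) m k → F k * ⟦ m ≡ᵇ k ⟧ ≡ F m * ⟦ m ≡ᵇ k ⟧
δ-subst F zero zero = refl
δ-subst F zero (suc k) = trans (*-zeroʳ (F (suc k))) (sym (*-zeroʳ (F zero)))
δ-subst F (suc m) zero = trans (*-zeroʳ (F zero)) (sym (*-zeroʳ (F (suc m))))
δ-subst F (suc m) (suc k) = δ-subst (λ j → F (suc j)) m k

-- central m = C(2m, m).
central : ℕ → ℕ
central m = bsum (twice m) (λ k → ⟦ m ≡ᵇ k ⟧)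

central-ratio : ∀ m → suc m * central (suc m) ≡ 2 * ((1 + 2 * m) * central m)
central-ratio m = begin
  suc m * (X + Y)             ≡⟨ cong (λ t → suc m * (X + t)) (sym X≡Y) ⟩
  suc m * (X + X)             ≡⟨ *-distrib-double (suc m) X ⟩
  2 * (suc m * X)             ≡⟨ cong (2 *_) (m+1·X) ⟩
  2 * (suc (twice m) * C)     ≡⟨ cong (λ t → 2 * (suc t * C)) (twice-≡ m) ⟩
  2 * ((1 + 2 * m) * C)       ∎
  where
  open ≡-Reasoning
  n = suc (twice m)
  C = central m
  X = bsum n (λ k → ⟦ suc m ≡ᵇ k ⟧)
  Y = bsum n (λ k → ⟦ m ≡ᵇ k ⟧)
  *-distrib-double : ∀ r x → r * (x + x) ≡ 2 * (r * x)
  *-distrib-double = solve-∀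
  m+m≡twice : m + m ≡ twice m
  m+m≡twice = trans (cong (m +_) (sym (+-identityʳ m))) (sym (twice-≡ m))
  -- C(2m+1, m+1) = C(2m+1, m)
  X≡Y : X ≡ Y
  X≡Y = bsum-reflect n λ k l k+l≡n → cong ⟦_⟧
    (reflects-agree (≡ᵇ-reflects-≡ (suc m) k) (≡ᵇ-reflects-≡ m l)
      (λ { refl → sym (+-cancelˡ-≡ m l m (trans (suc-injective k+l≡n) (sym m+m≡twice))) })
      (λ { refl → sym (+-cancelʳ-≡ m k (suc m) (trans k+l≡n (cong suc (sym m+m≡twice)))) }))
  -- (m+1)·C(2m+1, m+1) = (2m+1)·C(2m, m)
  m+1·X : suc m * X ≡ n * C
  m+1·X = begin
    suc m * X                       ≡⟨ sym (bsum-*ˡ n (suc m) _) ⟩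
    bsum n (λ k → suc m * ⟦ suc m ≡ᵇ k ⟧)
      ≡⟨ bsum-cong n (λ k → sym (δ-subst (λ j → j) (suc m) k)) ⟩
    bsum n (λ k → k * ⟦ suc m ≡ᵇ k ⟧)     ≡⟨ bsum-absorb (twice m) _ ⟩
    n * C                           ∎

central-polynomial : ∀ m →
  16 * (suc m * suc m * (1 + 4 * m)) ≤ 4 * ((1 + 2 * m) * (1 + 2 * m)) * (5 + 4 * m)
central-polynomial m = ≤-trans (m≤n+m _ 4) (≤-reflexive (difference-is-4 m))
  where
  difference-is-4 : ∀ m →
    4 + 16 * (suc m * suc m * (1 + 4 * m)) ≡ 4 * ((1 + 2 * m) * (1 + 2 * m)) * (5 + 4 * m)
  difference-is-4 = solve-∀

central-bound : ∀ m → 16 ^ m ≤ (1 + 4 * m) * (central m * central m)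
central-bound zero = ≤-refl
central-bound (suc m) = *-cancelˡ-≤ K (begin
  K * 16 ^ suc m                                  ≡⟨ e₁ K (16 ^ m) ⟩
  16 * K * 16 ^ m                                 ≤⟨ *-monoʳ-≤ (16 * K) (central-bound m) ⟩
  16 * K * ((1 + 4 * m) * (c * c))                ≤⟨ *-monoˡ-≤ _ (central-polynomial m) ⟩
  4 * ((1 + 2 * m) * (1 + 2 * m)) * (5 + 4 * m) * ((1 + 4 * m) * (c * c))  ≡⟨ e₂ m c ⟩
  (1 + 4 * m) * (5 + 4 * m) * (2 * ((1 + 2 * m) * c) * (2 * ((1 + 2 * m) * c)))
    ≡⟨ cong (λ t → (1 + 4 * m) * (5 + 4 * m) * (t * t)) (sym (central-ratio m)) ⟩
  (1 + 4 * m) * (5 + 4 * m) * (suc m * c′ * (suc m * c′)) ≡⟨ e₃ m c′ ⟩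
  K * ((1 + 4 * suc m) * (c′ * c′))               ∎)
  where
  open ≤-Reasoning
  c = central m
  c′ = central (suc m)
  K = suc m * suc m * (1 + 4 * m)
  e₁ : ∀ K x → K * (16 * x) ≡ 16 * K * x
  e₁ = solve-∀
  e₂ : ∀ m c → 4 * ((1 + 2 * m) * (1 + 2 * m)) * (5 + 4 * m) * ((1 + 4 * m) * (c * c))
             ≡ (1 + 4 * m) * (5 + 4 * m) * (2 * ((1 + 2 * m) * c) * (2 * ((1 + 2 * m) * c)))
  e₂ = solve-∀
  e₃ : ∀ m c′ → (1 + 4 * m) * (5 + 4 * m) * (suc m * c′ * (suc m * c′))
              ≡ suc m * suc m * (1 + 4 * m) * ((1 + 4 * suc m) * (c′ * c′))
  e₃ = solve-∀

-- The even case

XOR-count : ∀ n → sumCube (suc n) (λ z → ⟦ XOR z ⟧) ≡ 2 ^ n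
XOR-count n = begin
  sumCube (suc n) (λ z → ⟦ XOR z ⟧)                     ≡⟨ sumCube-split n _ ⟩
  sumOver L (λ x → ⟦ XOR x ⟧) + sumOver L (λ x → ⟦ not (XOR x) ⟧)
                                                        ≡⟨ sym (sumOver-+ L _ _) ⟩
  sumOver L (λ x → ⟦ XOR x ⟧ + ⟦ not (XOR x) ⟧)        ≡⟨ sumOver-cong L (λ x → one-of (XOR x)) ⟩
  sumCube n (λ _ → 1)                                   ≡⟨ sumCube-ones n (λ _ → 1) ⟩
  bsum n (λ _ → 1)                                      ≡⟨ bsum-one n ⟩
  2 ^ n                                                 ∎
  where
  open ≡-Reasoning
  L = allCube n
  one-of : ∀ b → ⟦ b ⟧ + ⟦ not b ⟧ ≡ 1
  one-of true = refl
  one-of false = refl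

trichotomy-count : ∀ a b → ⟦ a <ᵇ b ⟧ + ⟦ b <ᵇ a ⟧ + ⟦ a ≡ᵇ b ⟧ ≡ 1
trichotomy-count zero zero = refl
trichotomy-count zero (suc b) = refl
trichotomy-count (suc a) zero = refl
trichotomy-count (suc a) (suc b) = trichotomy-count a b

majority-mirror : ∀ {n k l} → k + l ≡ n → (n <ᵇ 2 * k) ≡ (2 * l <ᵇ n)
majority-mirror {n} {k} {l} k+l≡n =
  reflects-agree (<ᵇ-reflects-< n (2 * k)) (<ᵇ-reflects-< (2 * l) n)
    (λ n<2k → +-cancelˡ-< n (2 * l) n (begin-strict
      n + 2 * l      <⟨ +-monoˡ-< (2 * l) n<2k ⟩
      2 * k + 2 * l  ≡⟨ doubled ⟩
      n + n          ∎))
    (λ 2l<n → +-cancelʳ-< n n (2 * k) (begin-strict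
      n + n          ≡⟨ sym doubled ⟩
      2 * k + 2 * l  <⟨ +-monoʳ-< (2 * k) 2l<n ⟩
      2 * k + n      ∎))
  where
  open ≤-Reasoning
  doubled : 2 * k + 2 * l ≡ n + n
  doubled = trans (sym (*-distribˡ-+ 2 k l)) (trans (cong (2 *_) k+l≡n) (cong (n +_) (+-identityʳ n)))

-- In even dimension N the balanced layer |y| = N/2 is missed by Majority and by
-- its mirror image, so Majority holds on fewer than half of the points.
majority-count-even : ∀ m → let N = twice (suc m) in
  2 * sumCube N (λ y → ⟦ Majority y ⟧) < 2 ^ N
majority-count-even m = begin-strict
  2 * Maj                       ≡⟨ cong₂ _+_ Maj≡M (trans (+-identityʳ Maj) Maj≡M′) ⟩
  M + M′                        <⟨ m<m+n (M + M′) balanced-layer ⟩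
  M + M′ + E                    ≡⟨ cong (_+ E) (sym (bsum-+ N _ _)) ⟩
  bsum N (λ k → P k + P′ k) + E ≡⟨ sym (bsum-+ N _ _) ⟩
  bsum N (λ k → P k + P′ k + balanced k) ≡⟨ bsum-cong N (λ k → trichotomy-count N (2 * k)) ⟩
  bsum N (λ _ → 1)              ≡⟨ bsum-one N ⟩
  2 ^ N                         ∎
  where
  open ≤-Reasoning
  N = twice (suc m)
  P : ℕ → ℕ
  P k = ⟦ N <ᵇ 2 * k ⟧
  P′ : ℕ → ℕ
  P′ k = ⟦ 2 * k <ᵇ N ⟧
  -- M counts the Majority points, M′ (by reflection, equally many) the minority points
  M = bsum N P
  M′ = bsum N P′
  balanced : ℕ → ℕ
  balanced k = ⟦ N ≡ᵇ 2 * k ⟧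
  E = bsum N balanced
  Maj = sumCube N (λ y → ⟦ Majority y ⟧)
  Maj≡M : Maj ≡ M
  Maj≡M = sumCube-ones N P
  Maj≡M′ : Maj ≡ M′
  Maj≡M′ = trans Maj≡M (bsum-reflect N (λ k l e → cong ⟦_⟧ (majority-mirror {N} {k} {l} e)))
  balanced-layer : 0 < E
  balanced-layer = ≤-trans (≤-reflexive (sym (cong ⟦_⟧ middle))) (bsum-term N balanced m+1≤N)
    where
    m+1≤N : suc m ≤ N
    m+1≤N = s≤s (m≤n⇒m≤1+n (subst (m ≤_) (sym (twice-≡ m)) (m≤m+n m (m + 0))))
    middle : (N ≡ᵇ 2 * suc m) ≡ true
    middle = subst (λ t → (N ≡ᵇ t) ≡ true) (twice-≡ (suc m)) (≡ᵇ-refl N)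

-- In even dimension ≥ 2 no bijection carries XOR to Majority: the two functions
-- would be 1 equally often, but XOR is 1 on half the points and Majority on fewer.
no-bijection-even : ∀ m (φ : Cube (twice (suc m)) → Cube (twice (suc m))) → Bijective _≡_ _≡_ φ →
  ((z : Cube (twice (suc m))) → XOR z ≡ Majority (φ z)) → ⊥
no-bijection-even m φ bij hyp = <-irrefl refl (begin-strict
  2 * half              ≡⟨ cong (2 *_) counts-agree ⟩
  2 * Maj               <⟨ majority-count-even m ⟩
  2 ^ N                 ≡⟨⟩
  2 * half              ∎)
  where
  open ≤-Reasoning
  N = twice (suc m)
  half = 2 ^ suc (twice m)
  Maj = sumCube N (λ y → ⟦ Majority y ⟧)
  counts-agree : half ≡ Maj
  counts-agree = begin-equality
    half                                   ≡⟨ sym (XOR-count (suc (twice m))) ⟩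
    sumCube N (λ z → ⟦ XOR z ⟧)
      ≡⟨ sumOver-cong (allCube N) (λ z → cong ⟦_⟧ (hyp z)) ⟩
    sumCube N (λ z → ⟦ Majority (φ z) ⟧)   ≡⟨ sumCube-reindex N bij (λ y → ⟦ Majority y ⟧) ⟩
    Maj                                    ∎

-- The odd case

-- excess y = 2|y| ∸ n is positive exactly on the Majority half of {0,1}^n.
excess : ∀ {n} → Cube n → ℕ
excess {n} y = 2 * ones y ∸ n

minority-weight : ∀ {n} (y : Cube n) → Majority y ≡ false → 2 * ones y ≤ n
minority-weight y e = ≮⇒≥ (λ n<2|y| → subst T e (<⇒<ᵇ n<2|y|))

excess-minority : ∀ {n} (y : Cube n) → Majority y ≡ false → excess y ≡ 0
excess-minority y e = m≤n⇒m∸n≡0 (minority-weight y e)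

excess-≤-dist : ∀ {n} (a b : Cube n) → Majority b ≡ false → excess a ≤ 2 * dist a b
excess-≤-dist {n} a b e = begin
  2 * ones a ∸ n            ≤⟨ ∸-monoʳ-≤ (2 * ones a) (minority-weight b e) ⟩
  2 * ones a ∸ 2 * ones b   ≡⟨ sym (*-distribˡ-∸ 2 (ones a) (ones b)) ⟩
  2 * (ones a ∸ ones b)     ≤⟨ *-monoʳ-≤ 2 (m≤n+o⇒m∸n≤o (ones a) (ones b) (ones-triangle a b)) ⟩
  2 * dist a b              ∎
  where open ≤-Reasoning

-- Of two points on opposite sides of Majority only one has positive excess.
excess-pair : ∀ {n} (a b : Cube n) → Majority b ≡ not (Majority a) →
  excess a + excess b ≤ 2 * dist a b
excess-pair a b e with Majority a in ea
... | true = begin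
  excess a + excess b   ≡⟨ cong (excess a +_) (excess-minority b e) ⟩
  excess a + 0          ≡⟨ +-identityʳ (excess a) ⟩
  excess a              ≤⟨ excess-≤-dist a b e ⟩
  2 * dist a b          ∎
  where open ≤-Reasoning
... | false = begin
  excess a + excess b   ≡⟨ cong (_+ excess b) (excess-minority a ea) ⟩
  excess b              ≤⟨ excess-≤-dist b a ea ⟩
  2 * dist b a          ≡⟨ cong (2 *_) (dist-comm b a) ⟩
  2 * dist a b          ∎
  where open ≤-Reasoning

excess-≤-sensitivity : ∀ n (φ : Cube n → Cube n) → Bijective _≡_ _≡_ φ →
  ((z : Cube n) → XOR z ≡ Majority (φ z)) → (i : Fin n) →
  sumCube n excess ≤ sumCube n (λ x → dist (φ x) (φ (x +e i)))
excess-≤-sensitivity n φ bij hyp i = *-cancelˡ-≤ 2 (begin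
  2 * E                                              ≡⟨ cong (E +_) (+-identityʳ E) ⟩
  E + E                                              ≡⟨ sym (cong₂ _+_ along-φ along-flip) ⟩
  sumOver L (λ x → excess (φ x)) + sumOver L (λ x → excess (φ (x +e i)))
      ≡⟨ sym (sumOver-+ L _ _) ⟩
  sumOver L (λ x → excess (φ x) + excess (φ (x +e i)))
      ≤⟨ sumOver-mono L (λ x → excess-pair (φ x) _ (majority-flips x)) ⟩
  sumOver L (λ x → 2 * dist (φ x) (φ (x +e i)))      ≡⟨ sumOver-*ˡ L 2 _ ⟩
  2 * sumCube n (λ x → dist (φ x) (φ (x +e i)))      ∎)
  where
  open ≤-Reasoning
  L = allCube n
  E = sumCube n excess
  majority-flips : ∀ x → Majority (φ (x +e i)) ≡ not (Majority (φ x))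
  majority-flips x = trans (sym (hyp (x +e i))) (trans (XOR-flip x i) (cong not (hyp x)))
  along-φ : sumOver L (λ x → excess (φ x)) ≡ E
  along-φ = sumCube-reindex n bij excess
  along-flip : sumOver L (λ x → excess (φ (x +e i))) ≡ E
  along-flip = trans (sumCube-reindex n (flip-bijective i) (λ x → excess (φ x))) along-φ

lt-suc-count : ∀ m k → ⟦ m <ᵇ suc k ⟧ ≡ ⟦ m <ᵇ k ⟧ + ⟦ m ≡ᵇ k ⟧
lt-suc-count zero zero = refl
lt-suc-count zero (suc k) = refl
lt-suc-count (suc m) zero = refl
lt-suc-count (suc m) (suc k) = lt-suc-count m k

-- For n = 2m+1: (2k ∸ n) + n·[m < k] = 2k·[m < k], since 2k ≥ n exactly when k > m.
excess-split : ∀ m k →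
  (2 * k ∸ suc (twice m)) + suc (twice m) * ⟦ m <ᵇ k ⟧ ≡ 2 * (k * ⟦ m <ᵇ k ⟧)
excess-split m k with m <ᵇ k | <ᵇ-reflects-< m k
... | true | ofʸ m<k = begin
  (2 * k ∸ n) + n * 1   ≡⟨ cong ((2 * k ∸ n) +_) (*-identityʳ n) ⟩
  (2 * k ∸ n) + n       ≡⟨ m∸n+n≡m n≤2k ⟩
  2 * k                 ≡⟨ cong (2 *_) (sym (*-identityʳ k)) ⟩
  2 * (k * 1)           ∎
  where
  open ≡-Reasoning
  n = suc (twice m)
  n≤2k : n ≤ 2 * k
  n≤2k = ≤-trans (n≤1+n n) (≤-trans (≤-reflexive (twice-≡ (suc m))) (*-monoʳ-≤ 2 m<k))
... | false | ofⁿ m≮k = begin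
  (2 * k ∸ n) + n * 0   ≡⟨ cong ((2 * k ∸ n) +_) (*-zeroʳ n) ⟩
  (2 * k ∸ n) + 0       ≡⟨ +-identityʳ _ ⟩
  2 * k ∸ n             ≡⟨ m≤n⇒m∸n≡0 2k≤n ⟩
  0                     ≡⟨ cong (2 *_) (sym (*-zeroʳ k)) ⟩
  2 * (k * 0)           ∎
  where
  open ≡-Reasoning
  n = suc (twice m)
  2k≤n : 2 * k ≤ n
  2k≤n = ≤-trans (*-monoʳ-≤ 2 (≮⇒≥ m≮k)) (≤-trans (≤-reflexive (sym (twice-≡ m))) (n≤1+n _))

excess-bsum : ∀ m → bsum (suc (twice m)) (λ k → 2 * k ∸ suc (twice m)) ≡ suc (twice m) * central m
excess-bsum m = +-cancelʳ-≡ (n * (G + (G + C))) A (n * C) (begin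
  A + n * (G + (G + C))                       ≡⟨ cong (λ t → A + n * (G + t)) (sym G′≡G+C) ⟩
  A + n * bsum n (λ k → ⟦ m <ᵇ k ⟧)            ≡⟨ cong (A +_) (sym (bsum-*ˡ n n _)) ⟩
  A + bsum n (λ k → n * ⟦ m <ᵇ k ⟧)            ≡⟨ sym (bsum-+ n _ _) ⟩
  bsum n (λ k → (2 * k ∸ n) + n * ⟦ m <ᵇ k ⟧)  ≡⟨ bsum-cong n (excess-split m) ⟩
  bsum n (λ k → 2 * (k * ⟦ m <ᵇ k ⟧))          ≡⟨ bsum-*ˡ n 2 _ ⟩
  2 * bsum n (λ k → k * ⟦ m <ᵇ k ⟧)            ≡⟨ cong (2 *_) (bsum-absorb (twice m) _) ⟩
  2 * (n * G′)                                 ≡⟨ cong (λ t → 2 * (n * t)) G′≡G+C ⟩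
  2 * (n * (G + C))                            ≡⟨ regroup n G C ⟩
  n * C + n * (G + (G + C))                    ∎)
  where
  open ≡-Reasoning
  n = suc (twice m)
  C = central m
  A = bsum n (λ k → 2 * k ∸ n)
  G = bsum (twice m) (λ k → ⟦ m <ᵇ k ⟧)
  G′ = bsum (twice m) (λ k → ⟦ m <ᵇ suc k ⟧)
  G′≡G+C : G′ ≡ G + C
  G′≡G+C = trans (bsum-cong (twice m) (lt-suc-count m)) (bsum-+ (twice m) _ _)
  regroup : ∀ n G C → 2 * (n * (G + C)) ≡ n * C + n * (G + (G + C))
  regroup = solve-∀

four-pow-twice : ∀ m → 4 ^ twice m ≡ 16 ^ m
four-pow-twice zero = refl
four-pow-twice (suc m) = trans (cong (λ t → 4 * (4 * t)) (four-pow-twice m)) (sym (*-assoc 4 4 (16 ^ m)))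

odd-bound : ∀ m (φ : Cube (suc (twice m)) → Cube (suc (twice m))) → Bijective _≡_ _≡_ φ →
  ((z : Cube (suc (twice m))) → XOR z ≡ Majority (φ z)) → (i : Fin (suc (twice m))) →
  1 * 1 * suc (twice m) * (4 ^ suc (twice m))
    ≤ 3 * 3 * (sumCube (suc (twice m)) (λ x → dist (φ x) (φ (x +e i))) ^ 2)
odd-bound m φ bij hyp i = begin
  1 * 1 * n * 4 ^ n                    ≡⟨ cong (λ t → 1 * 1 * n * (4 * t)) (four-pow-twice m) ⟩
  1 * 1 * n * (4 * 16 ^ m)             ≡⟨ e₁ n (16 ^ m) ⟩
  4 * n * 16 ^ m                       ≤⟨ *-monoʳ-≤ (4 * n) (central-bound m) ⟩
  4 * n * ((1 + 4 * m) * (C * C))      ≡⟨ e₂ n m C ⟩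
  n * (4 * (1 + 4 * m)) * (C * C)      ≤⟨ *-monoˡ-≤ (C * C) (*-monoʳ-≤ n four-to-nine) ⟩
  n * (9 * n) * (C * C)                ≡⟨ e₃ n C ⟩
  9 * (n * C * (n * C))                ≤⟨ *-monoʳ-≤ 9 (*-mono-≤ nC≤S nC≤S) ⟩
  9 * (S * S)                          ≡⟨ cong (λ t → 9 * (S * t)) (sym (*-identityʳ S)) ⟩
  3 * 3 * (S ^ 2)                      ∎
  where
  open ≤-Reasoning
  n = suc (twice m)
  C = central m
  S = sumCube n (λ x → dist (φ x) (φ (x +e i)))
  nC≤S : n * C ≤ S
  nC≤S = begin
    n * C                        ≡⟨ sym (excess-bsum m) ⟩
    bsum n (λ k → 2 * k ∸ n)     ≡⟨ sym (sumCube-ones n _) ⟩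
    sumCube n excess             ≤⟨ excess-≤-sensitivity n φ bij hyp i ⟩
    S                            ∎
  four-to-nine : 4 * (1 + 4 * m) ≤ 9 * n
  four-to-nine = ≤-trans (m≤n+m _ (5 + 2 * m))
    (≤-reflexive (trans (poly m) (cong (λ t → 9 * suc t) (sym (twice-≡ m)))))
    where
    poly : ∀ m → 5 + 2 * m + 4 * (1 + 4 * m) ≡ 9 * suc (2 * m)
    poly = solve-∀
  e₁ : ∀ n x → 1 * 1 * n * (4 * x) ≡ 4 * n * x
  e₁ = solve-∀
  e₂ : ∀ n m c → 4 * n * ((1 + 4 * m) * (c * c)) ≡ n * (4 * (1 + 4 * m)) * (c * c)
  e₂ = solve-∀
  e₃ : ∀ n c → n * (9 * n) * (c * c) ≡ 9 * (n * c * (n * c))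
  e₃ = solve-∀

data EvenOrOdd : ℕ → Set where
  even : ∀ m → EvenOrOdd (twice m)
  odd  : ∀ m → EvenOrOdd (suc (twice m))

evenOrOdd : ∀ n → EvenOrOdd n
evenOrOdd zero = even zero
evenOrOdd (suc n) with evenOrOdd n
... | even m = odd m
... | odd m = even (suc m)

-- Proposition 7 with c = 1/3.  Dimension 0 has no direction i, even dimensions
-- admit no such φ, and odd dimensions are handled by odd-bound.
proposition7 : Σ ℕ λ p → Σ ℕ λ q → NonZero p × NonZero q ×
    ((n : ℕ) (φ : Cube n → Cube n) → Bijective _≡_ _≡_ φ →
      ((z : Cube n) → XOR z ≡ Majority (φ z)) → (i : Fin n) →
      (p * p) * n * (4 ^ n) ≤ (q * q) * (sumCube n (λ x → dist (φ x) (φ (x +e i))) ^ 2))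
proposition7 = 1 , 3 , _ , _ , λ n → bound n (evenOrOdd n)
  where
  bound : ∀ n → EvenOrOdd n → (φ : Cube n → Cube n) → Bijective _≡_ _≡_ φ →
    ((z : Cube n) → XOR z ≡ Majority (φ z)) → (i : Fin n) →
    1 * 1 * n * (4 ^ n) ≤ 3 * 3 * (sumCube n (λ x → dist (φ x) (φ (x +e i))) ^ 2)
  bound _ (even zero) _ _ _ ()
  bound _ (even (suc m)) φ bij hyp _ = ⊥-elim (no-bijection-even m φ bij hyp)
  bound _ (odd m) = odd-bound m
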